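{- Let $p$ be a non-empty path based on $\Gamma_1\vdash\Delta_1,\dots,\Gamma_n\vdash\Delta_n$. Then its view $\ulcorner p\urcorner$ is a chronicle based on $\Gamma_k\vdash\Delta_k$ for some $k\in\{1,\dots,n\}$.
   Context: Ludics (Girard). Loci are finite sequences of naturals; $\xi.i$ extends $\xi$ by $i$; $\xi'$ is a sublocus of $\xi$ if $\xi$ is a prefix of $\xi'$. An action is a proper action $(\epsilon,\xi,I)$ (polarity $\epsilon\in\{+,-\}$, focus $\xi$, finite ramification $I$) or the positive daimon $\maltese$; $(\epsilon,\xi.i,J)$ is justified by $(\bar\epsilon,\xi,I)$ when $i\in I$. A chronicle is a non-empty finite alternating sequence of actions such that: a positive proper action is either justified by an earlier action or initial; a negative action is either initial, and then the first action, or justified by the immediately preceding positive action; proper actions have distinct focuses; a daimon, if present, is last. A chronicle is based on $\Gamma\vdash\Delta$ ($\Delta$ a finite set of loci, $\Gamma$ at most one locus, no locus a sublocus of another) if the focus of its initial negative action (if any) is in $\Gamma$ and the focuses of its initial positive actions are in $\Delta$. A base of net is a non-empty finite set of sequents $\Gamma_1\vdash\Delta_1,\dots,\Gamma_n\vdash\Delta_n$ of pairwise disjoint loci, each $\Gamma_i$ containing exactly one locus except at most one which is empty, each $\Delta_i$ finite; an action is initial if its focus belongs to some $\Gamma_i\cup\Delta_i$. Views: $\ulcorner\epsilon\urcorner=\epsilon$, $\ulcorner\kappa\urcorner=\kappa$, $\ulcorner w\kappa^+\urcorner=\ulcorner w\urcorner\kappa^+$, $\ulcorner w\kappa^-\urcorner=\ulcorner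 w_0\urcorner\kappa^-$ where $w_0$ is empty if $\kappa^-$ is initial and otherwise the prefix of $w$ ending with the positive action justifying $\kappa^-$. A path based on the base of net is a finite sequence $p$ of actions, each either a daimon or with focus hereditarily justified by an element of some $\Gamma_i\cup\Delta_i$, such that: polarities alternate; each proper action is justified by an earlier action of $p$ or is initial with focus in some $\Gamma_i$ if negative and in some $\Delta_i$ if positive; for every prefix $q\kappa$ of $p$, if $\kappa$ is a positive proper action justified by a negative action $\kappa'$ then $\kappa'$ occurs in $\ulcorner q\urcorner$, and if $\kappa$ is an initial positive proper action with focus in $\Delta_i$ then either $\kappa$ is the first action of $p$ and $\Gamma_i=\emptyset$, or $\kappa$ is immediately preceded in $p$ by a negative action whose focus is hereditarily justified by an element of $\Gamma_i\cup\Delta_i$; proper actions have distinct focuses; a daimon, if present, is last, and if it is the first action then some $\Gamma_i$ is empty; if some $\Gamma_i$ is empty then $p$ is non-empty and begins with $\maltese$ or with a positive action with focus in $\Delta_i$. -}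

module Defs where

open import Data.Nat using (ℕ)
open import Data.Nat.Properties using (_≟_)
open import Data.List using (List; []; _∷_; _++_; [_]; length; lookup; reverse; concatMap; mapMaybe)
import Data.List.Properties as LP
open import Data.List.Relation.Unary.Any using (Any; any?)
open import Data.List.Relation.Unary.AllPairs using (AllPairs)
open import Data.List.Relation.Unary.Unique.Propositional using (Unique)
open import Data.List.Membership.Propositional using (_∈_)
import Data.List.Membership.DecPropositional as DecMem
open import Data.Maybe using (Maybe; just; nothing)
open import Data.Product using (Σ; ∃; _×_; _,_)
open import Data.Sum using (_⊎_)
open import Data.Unit using (⊤)
open import Data.Empty using (⊥)
open import Data.Fin using (Fin)
open import Relation.Nullary using (¬_; Dec; yes; no; does)
open import Relation.Nullary.Decidable using (_×-dec_)
open import Relation.Binary.PropositionalEquality using (_≡_; _≢_; refl)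
open import Data.Bool using (Bool; true; false; if_then_else_)

-- A locus is a finite sequence of naturals; ξ.i is ξ ++ [ i ].
Locus : Set
Locus = List ℕ

_≟L_ : (ξ ζ : Locus) → Dec (ξ ≡ ζ)
_≟L_ = LP.≡-dec _≟_

IsSublocus : Locus → Locus → Set
IsSublocus ξ' ξ = ∃ λ ρ → ξ ++ ρ ≡ ξ'

data Pol : Set where
  pos neg : Pol

dual : Pol → Pol
dual pos = neg
dual neg = pos

_≟P_ : (a b : Pol) → Dec (a ≡ b)
pos ≟P pos = yes refl
pos ≟P neg = no λ ()
neg ≟P pos = no λ ()
neg ≟P neg = yes refl

-- proper action (ε, ξ, I), finite ramification I given as a list; or the daimon
data Action : Set where
  daimon : Action
  act    : Pol → Locus → List ℕ → Action

polarity : Action → Pol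
polarity daimon      = pos
polarity (act ε _ _) = ε

focus? : Action → Maybe Locus
focus? daimon      = nothing
focus? (act _ ξ _) = just ξ

Justifies : Action → Action → Set
Justifies (act ε' ξ I) (act ε ζ J) = (ε ≡ dual ε') × Any (λ i → ζ ≡ ξ ++ [ i ]) I
Justifies _ _ = ⊥

justifies? : (κ' κ : Action) → Dec (Justifies κ' κ)
justifies? daimon      daimon      = no λ ()
justifies? daimon      (act _ _ _) = no λ ()
justifies? (act _ _ _) daimon      = no λ ()
justifies? (act ε' ξ I) (act ε ζ J) =
  (ε ≟P dual ε') ×-dec any? (λ i → ζ ≟L (ξ ++ [ i ])) I

foci : List Action → List Locus
foci = mapMaybe focus?

Alternating : List Action → Set
Alternating p = ∀ q κ κ' r → p ≡ q ++ κ ∷ κ' ∷ r → polarity κ' ≡ dual (polarity κ)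

DaimonLast : List Action → Set
DaimonLast p = ∀ q r → p ≡ q ++ daimon ∷ r → r ≡ []

record Sequent : Set where
  constructor _⊢_
  field
    Γ : Maybe Locus
    Δ : List Locus
open Sequent public

maybeToList : Maybe Locus → List Locus
maybeToList nothing  = []
maybeToList (just ξ) = ξ ∷ []

seqLoci : Sequent → List Locus
seqLoci s = maybeToList (Γ s) ++ Δ s

baseLoci : List Sequent → List Locus
baseLoci = concatMap seqLoci

Disjoint : Locus → Locus → Set
Disjoint σ τ = ¬ IsSublocus σ τ × ¬ IsSublocus τ σ

record IsBase (B : List Sequent) : Set where
  field
    nonEmpty : B ≢ []
    disjoint : AllPairs Disjoint (baseLoci B)
    atMostOneEmpty : ∀ (i j : Fin (length B)) →
      Γ (lookup B i) ≡ nothing → Γ (lookup B j) ≡ nothing → i ≡ j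

InitialIn : List Locus → Action → Set
InitialIn L daimon      = ⊥
InitialIn L (act _ ξ _) = ξ ∈ L

initialIn? : (L : List Locus) (κ : Action) → Dec (InitialIn L κ)
initialIn? L daimon      = no λ ()
initialIn? L (act _ ξ _) = DecMem._∈?_ _≟L_ ξ L

HerJustIn : List Locus → Locus → Set
HerJustIn L ξ = Any (λ σ → IsSublocus ξ σ) L

-- viewR works on reversed sequences (last action first)
mutual
  viewR : List Locus → List Action → List Action
  viewR L [] = []
  viewR L (κ ∷ w) with polarity κ
  ... | pos = κ ∷ viewR L w
  ... | neg with does (initialIn? L κ)
  ...   | true  = κ ∷ []
  ...   | false = κ ∷ seek L κ w

  -- drop actions until the positive action justifying κ, then take the view
  -- of the prefix ending with it (empty if there is none)
  seek : List Locus → Action → List Action → List Action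
  seek L κ [] = []
  seek L κ (a ∷ w) with does (justifies? a κ)
  ... | true  = a ∷ viewR L w
  ... | false = seek L κ w

view : List Sequent → List Action → List Action
view B w = reverse (viewR (baseLoci B) (reverse w))

record IsPath (B : List Sequent) (p : List Action) : Set where
  field
    hereditary : ∀ {κ} → κ ∈ p → κ ≡ daimon ⊎ (∃ λ ξ → focus? κ ≡ just ξ × HerJustIn (baseLoci B) ξ)
    alternating : Alternating p
    justifiedOrInitial : ∀ q ε ξ I r → p ≡ q ++ act ε ξ I ∷ r →
      (∃ λ κ' → κ' ∈ q × Justifies κ' (act ε ξ I))
      ⊎ ((ε ≡ neg × Any (λ s → Γ s ≡ just ξ) B) ⊎ (ε ≡ pos × Any (λ s → ξ ∈ Δ s) B))
    viewCondition : ∀ q ξ I r κ' → p ≡ q ++ act pos ξ I ∷ r →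
      κ' ∈ q → polarity κ' ≡ neg → Justifies κ' (act pos ξ I) → κ' ∈ view B q
    initialCondition : ∀ q ξ I r (i : Fin (length B)) → p ≡ q ++ act pos ξ I ∷ r →
      ξ ∈ Δ (lookup B i) →
      (q ≡ [] × Γ (lookup B i) ≡ nothing)
      ⊎ (∃ λ q' → ∃ λ ζ → ∃ λ J → q ≡ q' ++ [ act neg ζ J ]
            × HerJustIn (seqLoci (lookup B i)) ζ)
    distinctFoci : Unique (foci p)
    daimonLast : DaimonLast p
    daimonFirst : ∀ r → p ≡ daimon ∷ r → ∃ λ (i : Fin (length B)) → Γ (lookup B i) ≡ nothing
    emptyΓ : ∀ (i : Fin (length B)) → Γ (lookup B i) ≡ nothing →
      ∃ λ κ → ∃ λ r → p ≡ κ ∷ r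
        × (κ ≡ daimon ⊎ (∃ λ ξ → ∃ λ I → κ ≡ act pos ξ I × ξ ∈ Δ (lookup B i)))

record IsChronicleBasedOn (s : Sequent) (c : List Action) : Set where
  field
    nonEmpty : c ≢ []
    alternating : Alternating c
    positiveCond : ∀ q ξ I r → c ≡ q ++ act pos ξ I ∷ r →
      (∃ λ κ' → κ' ∈ q × Justifies κ' (act pos ξ I)) ⊎ InitialIn (seqLoci s) (act pos ξ I)
    negativeCond : ∀ q ξ I r → c ≡ q ++ act neg ξ I ∷ r →
      (InitialIn (seqLoci s) (act neg ξ I) × q ≡ [])
      ⊎ (∃ λ q' → ∃ λ κ' → q ≡ q' ++ [ κ' ] × polarity κ' ≡ pos × Justifies κ' (act neg ξ I))
    distinctFoci : Unique (foci c)
    daimonLast : DaimonLast c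
    basedNeg : ∀ ξ I → act neg ξ I ∈ c → InitialIn (seqLoci s) (act neg ξ I) → Γ s ≡ just ξ
    basedPos : ∀ ξ I → act pos ξ I ∈ c → InitialIn (seqLoci s) (act pos ξ I) → ξ ∈ Δ s

-- The view of a prefix q κ of p is the view of a strictly shorter prefix followed by κ: of q
-- itself when κ is positive, of the prefix ending with the justifier of κ when κ is a justified
-- negative action, and of the empty prefix when κ is initial negative. So by well-founded induction
-- along p the view grows one action at a time, and each step preserves the chronicle conditions:
-- the justifier of a positive action lies in the view by the view condition on paths, and an
-- initial positive action follows a negative action hereditarily justified in its own sequent.
-- Since every action of a chronicle is hereditarily justified by the loci of its base, the
-- disjointness of the base of net forces this sequent Γₖ ⊢ Δₖ to be the same at every step.
module Submission where

open import Defs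
open import Data.Nat using (_<_; s≤s; z≤n)
open import Data.Nat.Induction using (<-wellFounded)
open import Induction.WellFounded using (Acc; acc)
open import Data.List using (List; []; _∷_; _++_; [_]; _∷ʳ_; length; lookup; reverse; initLast; _∷ʳ′_)
open import Data.List.Properties
  using (++-assoc; ++-identityʳ; ++-identityʳ-unique; ∷-injective; ∷-injectiveˡ; ∷-injectiveʳ;
         ∷ʳ-injectiveʳ; ∷ʳ-++; mapMaybe-++; reverse-++; reverse-involutive; unfold-reverse)
open import Data.List.Relation.Unary.Any using (Any; here; there; index)
import Data.List.Relation.Unary.Any as Any
open import Data.List.Relation.Unary.Any.Properties using (lookup-index; ¬Any[]; reverse⁺; reverse⁻)
open import Data.List.Relation.Unary.All using (All; []; _∷_)
import Data.List.Relation.Unary.All as All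
import Data.List.Relation.Unary.All.Properties as AllP
open import Data.List.Relation.Unary.AllPairs using (AllPairs; []; _∷_)
open import Data.List.Relation.Unary.Unique.Propositional using (Unique)
import Data.List.Relation.Unary.Unique.Propositional.Properties as UniqueP
open import Data.List.Membership.Propositional using (_∈_; _∉_; find; lose)
open import Data.List.Membership.Propositional.Properties using (∈-++⁺ˡ; ∈-++⁺ʳ; ∈-++⁻; ∈-∃++)
open import Data.List.Relation.Binary.Subset.Propositional using (_⊆_)
import Data.List.Relation.Binary.Subset.Propositional.Properties as SubsetP
open import Data.Fin using (Fin; zero; suc)
open import Data.Maybe using (just)
open import Data.Product using (∃; ∃₂; _×_; _,_; proj₁; proj₂; map₂)
open import Data.Sum using (_⊎_; inj₁; inj₂)
import Data.Sum as Sum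
open import Data.Unit using (⊤; tt)
open import Data.Bool using (true; false)
open import Data.Empty using (⊥-elim)
open import Function using (_∘_)
open import Relation.Nullary using (¬_; yes; no; does)
open import Relation.Binary.PropositionalEquality using (_≡_; _≢_; refl; sym; trans; cong; subst; module ≡-Reasoning)

++-∷≢[] : ∀ {A : Set} (xs : List A) {x ys} → xs ++ x ∷ ys ≢ []
++-∷≢[] [] ()
++-∷≢[] (_ ∷ _) ()

∷ʳ-split : ∀ {A : Set} (V : List A) {κ} q {x r} → V ∷ʳ κ ≡ q ++ x ∷ r →
  (q ≡ V × x ≡ κ × r ≡ []) ⊎ (∃ λ r′ → r ≡ r′ ∷ʳ κ × V ≡ q ++ x ∷ r′)
∷ʳ-split [] [] refl = inj₁ (refl , refl , refl)
∷ʳ-split [] (_ ∷ []) ()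
∷ʳ-split [] (_ ∷ _ ∷ _) ()
∷ʳ-split (v ∷ V) [] refl = inj₂ (V , refl , refl)
∷ʳ-split (v ∷ V) (y ∷ q) e with refl , e′ ← ∷-injective e with ∷ʳ-split V q e′
... | inj₁ (refl , x≡κ , r≡[]) = inj₁ (refl , x≡κ , r≡[])
... | inj₂ (r′ , r≡ , V≡) = inj₂ (r′ , r≡ , cong (v ∷_) V≡)

length-<-++-∷ : ∀ {A : Set} (xs : List A) {y ys} → length xs < length (xs ++ y ∷ ys)
length-<-++-∷ [] = s≤s z≤n
length-<-++-∷ (_ ∷ xs) = s≤s (length-<-++-∷ xs)

reverse-++-∷ : ∀ {A : Set} (xs : List A) a ys → reverse (xs ++ a ∷ ys) ≡ reverse ys ++ a ∷ reverse xs
reverse-++-∷ xs a ys = begin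
  reverse (xs ++ a ∷ ys)        ≡⟨ reverse-++ xs (a ∷ ys) ⟩
  reverse (a ∷ ys) ++ reverse xs ≡⟨ cong (_++ reverse xs) (unfold-reverse a ys) ⟩
  reverse ys ∷ʳ a ++ reverse xs  ≡⟨ ∷ʳ-++ (reverse ys) a (reverse xs) ⟩
  reverse ys ++ a ∷ reverse xs   ∎
  where open ≡-Reasoning

Unique-++-∷⇒∉ : ∀ {A : Set} (xs : List A) {y ys} → Unique (xs ++ y ∷ ys) → y ∉ xs
Unique-++-∷⇒∉ (_ ∷ xs) (x≢ ∷ _) (here refl) = All.lookup x≢ (∈-++⁺ʳ xs (here refl)) refl
Unique-++-∷⇒∉ (_ ∷ xs) (_ ∷ u) (there y∈xs) = Unique-++-∷⇒∉ xs u y∈xs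

AllPairs-++⁻ : ∀ {A : Set} {R : A → A → Set} xs {ys} → AllPairs R (xs ++ ys) →
  AllPairs R ys × All (λ x → All (R x) ys) xs
AllPairs-++⁻ [] rs = rs , []
AllPairs-++⁻ (x ∷ xs) (r ∷ rs) = let rys , rxys = AllPairs-++⁻ xs rs in rys , AllP.++⁻ʳ xs r ∷ rxys

Comparable : Locus → Locus → Set
Comparable σ τ = IsSublocus σ τ ⊎ IsSublocus τ σ

common-sublocus⇒comparable : ∀ σ τ {ζ} → IsSublocus ζ σ → IsSublocus ζ τ → Comparable σ τ
common-sublocus⇒comparable [] τ _ _ = inj₂ (τ , refl)
common-sublocus⇒comparable (x ∷ σ) [] _ _ = inj₁ (x ∷ σ , refl)
common-sublocus⇒comparable (x ∷ σ) (y ∷ τ) {[]} (_ , ()) _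
common-sublocus⇒comparable (x ∷ σ) (y ∷ τ) {z ∷ ζ} (ρ₁ , e₁) (ρ₂ , e₂)
  with refl , e₁′ ← ∷-injective e₁ | refl , e₂′ ← ∷-injective e₂ =
  Sum.map (map₂ (cong (x ∷_))) (map₂ (cong (x ∷_)))
          (common-sublocus⇒comparable σ τ (ρ₁ , e₁′) (ρ₂ , e₂′))

Disjoint⇒¬Comparable : ∀ {σ τ} → Disjoint σ τ → ¬ Comparable σ τ
Disjoint⇒¬Comparable (σ⋢τ , τ⋢σ) = Sum.[ σ⋢τ , τ⋢σ ]

HerJustIn-refl : ∀ {M ξ} → ξ ∈ M → HerJustIn M ξ
HerJustIn-refl = Any.map λ { refl → [] , ++-identityʳ _ }

HerJustIn-child : ∀ {M ζ} i → HerJustIn M ζ → HerJustIn M (ζ ∷ʳ i)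
HerJustIn-child i = Any.map λ { {σ} (ρ , refl) → ρ ∷ʳ i , sym (++-assoc σ ρ [ i ]) }

disjoint-extension-≡[] : ∀ {L} → AllPairs Disjoint L → ∀ {σ τ ρ} →
  σ ∈ L → τ ∈ L → σ ++ ρ ≡ τ → ρ ≡ []
disjoint-extension-≡[] (_ ∷ _) {σ} (here refl) (here refl) e = ++-identityʳ-unique σ (sym e)
disjoint-extension-≡[] (σ# ∷ _) (here refl) (there τ∈) e = ⊥-elim (proj₂ (All.lookup σ# τ∈) (_ , e))
disjoint-extension-≡[] (τ# ∷ _) (there σ∈) (here refl) e = ⊥-elim (proj₁ (All.lookup τ# σ∈) (_ , e))
disjoint-extension-≡[] (_ ∷ ds) (there σ∈) (there τ∈) e = disjoint-extension-≡[] ds σ∈ τ∈ e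

Γ⊆seqLoci : ∀ s {ξ} → Γ s ≡ just ξ → ξ ∈ seqLoci s
Γ⊆seqLoci (just _ ⊢ _) refl = here refl

Δ⊆seqLoci : ∀ s → Δ s ⊆ seqLoci s
Δ⊆seqLoci s = ∈-++⁺ʳ (maybeToList (Γ s))

seqLoci⊆baseLoci : ∀ B (k : Fin (length B)) → seqLoci (lookup B k) ⊆ baseLoci B
seqLoci⊆baseLoci (s ∷ B) zero = ∈-++⁺ˡ
seqLoci⊆baseLoci (s ∷ B) (suc k) = ∈-++⁺ʳ (seqLoci s) ∘ seqLoci⊆baseLoci B k

seqLoci-disjoint-baseLoci : ∀ s B → AllPairs Disjoint (baseLoci (s ∷ B)) → ∀ {σ τ} →
  σ ∈ seqLoci s → τ ∈ baseLoci B → Disjoint σ τ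
seqLoci-disjoint-baseLoci s B ds σ∈ = All.lookup (All.lookup (proj₂ (AllPairs-++⁻ (seqLoci s) ds)) σ∈)

comparable⇒same-sequent : ∀ B → AllPairs Disjoint (baseLoci B) → (i k : Fin (length B)) → ∀ {σ τ} →
  σ ∈ seqLoci (lookup B i) → τ ∈ seqLoci (lookup B k) → Comparable σ τ → i ≡ k
comparable⇒same-sequent (s ∷ B) ds zero zero _ _ _ = refl
comparable⇒same-sequent (s ∷ B) ds zero (suc k) σ∈ τ∈ c =
  ⊥-elim (Disjoint⇒¬Comparable (seqLoci-disjoint-baseLoci s B ds σ∈ (seqLoci⊆baseLoci B k τ∈)) c)
comparable⇒same-sequent (s ∷ B) ds (suc i) zero σ∈ τ∈ c =
  ⊥-elim (Disjoint⇒¬Comparable (seqLoci-disjoint-baseLoci s B ds τ∈ (seqLoci⊆baseLoci B i σ∈)) (Sum.swap c))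
comparable⇒same-sequent (s ∷ B) ds (suc i) (suc k) σ∈ τ∈ c =
  cong suc (comparable⇒same-sequent B (proj₁ (AllPairs-++⁻ (seqLoci s) ds)) i k σ∈ τ∈ c)

HerJustIn-same-sequent : ∀ B → AllPairs Disjoint (baseLoci B) → (i k : Fin (length B)) → ∀ {ζ} →
  HerJustIn (seqLoci (lookup B i)) ζ → HerJustIn (seqLoci (lookup B k)) ζ → i ≡ k
HerJustIn-same-sequent B ds i k ζ↑ᵢ ζ↑ₖ
  with σ , σ∈ , σ⊑ ← find ζ↑ᵢ | τ , τ∈ , τ⊑ ← find ζ↑ₖ =
  comparable⇒same-sequent B ds i k σ∈ τ∈ (common-sublocus⇒comparable σ τ σ⊑ τ⊑)

RootedIn : List Locus → Action → Set
RootedIn M daimon = ⊤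
RootedIn M (act _ ξ _) = HerJustIn M ξ

RootedIn-justified : ∀ {M κ′ κ} → RootedIn M κ′ → Justifies κ′ κ → RootedIn M κ
RootedIn-justified {κ′ = act _ _ _} {act _ _ _} ζ↑ (_ , i∈I) with i , _ , refl ← find i∈I =
  HerJustIn-child i ζ↑

justified⇒¬InitialIn : ∀ {L κ′ κ} → AllPairs Disjoint L →
  RootedIn L κ′ → Justifies κ′ κ → ¬ InitialIn L κ
justified⇒¬InitialIn {κ′ = act _ _ _} {act _ _ _} ds ζ↑ (_ , i∈I) ξ∈L
  with i , _ , refl ← find i∈I | σ , σ∈L , (ρ , refl) ← find ζ↑ =
  ++-∷≢[] ρ (disjoint-extension-≡[] ds σ∈L ξ∈L (sym (++-assoc σ ρ [ i ])))

justifier-polarity : ∀ {κ′ κ} → Justifies κ′ κ → polarity κ′ ≡ dual (polarity κ)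
justifier-polarity {act pos _ _} {act _ _ _} (refl , _) = refl
justifier-polarity {act neg _ _} {act _ _ _} (refl , _) = refl

act∈⇒focus∈foci : ∀ {q ε ξ I} → act ε ξ I ∈ q → ξ ∈ foci q
act∈⇒focus∈foci {daimon ∷ _} (there m) = act∈⇒focus∈foci m
act∈⇒focus∈foci {act _ _ _ ∷ _} (here refl) = here refl
act∈⇒focus∈foci {act _ _ _ ∷ _} (there m) = there (act∈⇒focus∈foci m)

foci-⊆ : ∀ {V W} → V ⊆ W → foci V ⊆ foci W
foci-⊆ {daimon ∷ _} V⊆W m = foci-⊆ (V⊆W ∘ there) m
foci-⊆ {act _ _ _ ∷ _} V⊆W (here refl) = act∈⇒focus∈foci (V⊆W (here refl))
foci-⊆ {act _ _ _ ∷ _} V⊆W (there m) = foci-⊆ (V⊆W ∘ there) m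

-- The bodies of positiveCond and negativeCond of IsChronicleBasedOn, for κ following q.
Enabled : Sequent → List Action → Action → Set
Enabled s q daimon = ⊤
Enabled s q (act pos ξ I) =
  (∃ λ κ′ → κ′ ∈ q × Justifies κ′ (act pos ξ I)) ⊎ InitialIn (seqLoci s) (act pos ξ I)
Enabled s q (act neg ξ I) =
  (InitialIn (seqLoci s) (act neg ξ I) × q ≡ [])
  ⊎ (∃ λ q′ → ∃ λ κ′ → q ≡ q′ ++ [ κ′ ] × polarity κ′ ≡ pos × Justifies κ′ (act neg ξ I))

BasedOn : Sequent → Action → Set
BasedOn s daimon = ⊤
BasedOn s (act pos ξ I) = InitialIn (seqLoci s) (act pos ξ I) → ξ ∈ Δ s
BasedOn s (act neg ξ I) = InitialIn (seqLoci s) (act neg ξ I) → Γ s ≡ just ξ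

FreshFocus : List Action → Action → Set
FreshFocus V daimon = ⊤
FreshFocus V (act _ ξ _) = ξ ∉ foci V

enabled : ∀ {s c q κ r} → IsChronicleBasedOn s c → c ≡ q ++ κ ∷ r → Enabled s q κ
enabled {κ = daimon} _ _ = tt
enabled {q = q} {act pos ξ I} {r} ch = IsChronicleBasedOn.positiveCond ch q ξ I r
enabled {q = q} {act neg ξ I} {r} ch = IsChronicleBasedOn.negativeCond ch q ξ I r

based : ∀ {s c κ} → IsChronicleBasedOn s c → κ ∈ c → BasedOn s κ
based {κ = daimon} _ _ = tt
based {κ = act pos ξ I} ch = IsChronicleBasedOn.basedPos ch ξ I
based {κ = act neg ξ I} ch = IsChronicleBasedOn.basedNeg ch ξ I

enabled-rooted : ∀ {s q} κ → All (RootedIn (seqLoci s)) q → Enabled s q κ → RootedIn (seqLoci s) κ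
enabled-rooted daimon _ _ = tt
enabled-rooted (act pos _ _) rq (inj₁ (_ , κ′∈q , J)) = RootedIn-justified (All.lookup rq κ′∈q) J
enabled-rooted (act pos _ _) rq (inj₂ ξ∈) = HerJustIn-refl ξ∈
enabled-rooted (act neg _ _) rq (inj₁ (ξ∈ , _)) = HerJustIn-refl ξ∈
enabled-rooted (act neg _ _) rq (inj₂ (q′ , _ , refl , _ , J)) =
  RootedIn-justified (All.lookup rq (∈-++⁺ʳ q′ (here refl))) J

chronicle-rooted : ∀ {s c} → IsChronicleBasedOn s c → All (RootedIn (seqLoci s)) c
chronicle-rooted {s} {c} ch = go [] c refl []
  where
  go : ∀ q r → c ≡ q ++ r → All (RootedIn (seqLoci s)) q → All (RootedIn (seqLoci s)) c
  go q [] e rq = subst (All _) (sym (trans e (++-identityʳ q))) rq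
  go q (κ ∷ r) e rq =
    go (q ∷ʳ κ) r (trans e (sym (∷ʳ-++ q κ r))) (AllP.++⁺ rq (enabled-rooted κ rq (enabled ch e) ∷ []))

Unique-foci-∷ʳ : ∀ V κ → Unique (foci V) → FreshFocus V κ → Unique (foci (V ∷ʳ κ))
Unique-foci-∷ʳ V daimon u _ rewrite mapMaybe-++ focus? V [ daimon ] | ++-identityʳ (foci V) = u
Unique-foci-∷ʳ V (act ε ξ I) u ξ∉ rewrite mapMaybe-++ focus? V [ act ε ξ I ] =
  UniqueP.++⁺ u ([] ∷ []) λ { (ξ∈ , here refl) → ξ∉ ξ∈ }

chronicle-[_] : ∀ {s} κ → Enabled s [] κ → BasedOn s κ → IsChronicleBasedOn s [ κ ]
chronicle-[_] {s} κ en bo = record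
  { nonEmpty = λ ()
  ; alternating = λ { [] _ _ _ () ; (_ ∷ []) _ _ _ () ; (_ ∷ _ ∷ _) _ _ _ () }
  ; positiveCond = λ q _ _ _ → enabled-[] q
  ; negativeCond = λ q _ _ _ → enabled-[] q
  ; distinctFoci = Unique-foci-∷ʳ [] κ [] (fresh-in-[] κ)
  ; daimonLast = daimon-last
  ; basedNeg = λ _ _ → based-[]
  ; basedPos = λ _ _ → based-[]
  }
  where
  enabled-[] : ∀ q {x r} → [ κ ] ≡ q ++ x ∷ r → Enabled s q x
  enabled-[] [] refl = en
  enabled-[] (_ ∷ []) ()
  enabled-[] (_ ∷ _ ∷ _) ()

  daimon-last : DaimonLast [ κ ]
  daimon-last [] _ e = sym (∷-injectiveʳ e)
  daimon-last (_ ∷ []) _ ()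
  daimon-last (_ ∷ _ ∷ _) _ ()

  based-[] : ∀ {x} → x ∈ [ κ ] → BasedOn s x
  based-[] (here refl) = bo

  fresh-in-[] : ∀ x → FreshFocus [] x
  fresh-in-[] daimon = tt
  fresh-in-[] (act _ _ _) ()

chronicle-∷ʳ : ∀ {s V W y κ} → IsChronicleBasedOn s V →
  V ≡ W ∷ʳ y → polarity κ ≡ dual (polarity y) → Enabled s V κ →
  FreshFocus V κ → daimon ∉ V → BasedOn s κ → IsChronicleBasedOn s (V ∷ʳ κ)
chronicle-∷ʳ {s} {V} {W} {y} {κ} ch refl alt en fresh d∉ bo = record
  { nonEmpty = ++-∷≢[] V
  ; alternating = alternating
  ; positiveCond = λ q _ _ _ → enabled′ q
  ; negativeCond = λ q _ _ _ → enabled′ q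
  ; distinctFoci = Unique-foci-∷ʳ V κ (IsChronicleBasedOn.distinctFoci ch) fresh
  ; daimonLast = daimonLast
  ; basedNeg = λ _ _ → based′
  ; basedPos = λ _ _ → based′
  }
  where
  enabled′ : ∀ q {x r} → V ∷ʳ κ ≡ q ++ x ∷ r → Enabled s q x
  enabled′ q e with ∷ʳ-split V q e
  ... | inj₁ (refl , refl , _) = en
  ... | inj₂ (_ , _ , e′) = enabled ch e′

  based′ : ∀ {x} → x ∈ V ∷ʳ κ → BasedOn s x
  based′ m with ∈-++⁻ V m
  ... | inj₁ x∈V = based ch x∈V
  ... | inj₂ (here refl) = bo

  alternating : Alternating (V ∷ʳ κ)
  alternating q a b r e with ∷ʳ-split V q e
  ... | inj₁ (_ , _ , ())
  ... | inj₂ ([] , e₁ , e₂) with refl ← ∷-injectiveˡ e₁ | refl ← ∷ʳ-injectiveʳ W q e₂ = alt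
  ... | inj₂ (_ ∷ r′ , e₁ , e₂) with refl ← ∷-injectiveˡ e₁ =
    IsChronicleBasedOn.alternating ch q a b r′ e₂

  daimonLast : DaimonLast (V ∷ʳ κ)
  daimonLast q r e with ∷ʳ-split V q e
  ... | inj₁ (_ , _ , r≡[]) = r≡[]
  ... | inj₂ (_ , _ , e′) = ⊥-elim (d∉ (subst (daimon ∈_) (sym e′) (∈-++⁺ʳ q (here refl))))

viewR-head : ∀ L x w → ∃ λ T → viewR L (x ∷ w) ≡ x ∷ T
viewR-head L x w with polarity x
... | pos = _ , refl
... | neg with does (initialIn? L x)
...   | true = _ , refl
...   | false = _ , refl

viewR-pos : ∀ L x w → polarity x ≡ pos → viewR L (x ∷ w) ≡ x ∷ viewR L w
viewR-pos L x w x⁺ with polarity x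
viewR-pos L x w refl | pos = refl

viewR-initial : ∀ L {ξ I} w → ξ ∈ L → viewR L (act neg ξ I ∷ w) ≡ [ act neg ξ I ]
viewR-initial L {ξ} {I} w ξ∈L with initialIn? L (act neg ξ I)
... | yes _ = refl
... | no ξ∉L = ⊥-elim (ξ∉L ξ∈L)

viewR-justified : ∀ L {ξ I} w → ξ ∉ L → viewR L (act neg ξ I ∷ w) ≡ act neg ξ I ∷ seek L (act neg ξ I) w
viewR-justified L {ξ} {I} w ξ∉L with initialIn? L (act neg ξ I)
... | yes ξ∈L = ⊥-elim (ξ∉L ξ∈L)
... | no _ = refl

seek-justifier : ∀ L κ w → Any (λ a → Justifies a κ) w →
  ∃₂ λ w₁ a → ∃ λ w₂ → w ≡ w₁ ++ a ∷ w₂ × Justifies a κ × seek L κ w ≡ a ∷ viewR L w₂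
seek-justifier L κ (a ∷ w) J with justifies? a κ
... | yes Ja = [] , a , w , refl , Ja , refl
seek-justifier L κ (a ∷ w) (here Ja) | no ¬Ja = ⊥-elim (¬Ja Ja)
seek-justifier L κ (a ∷ w) (there J) | no _ with w₁ , b , w₂ , refl , Jb , e ← seek-justifier L κ w J =
  a ∷ w₁ , b , w₂ , refl , Jb , e

mutual
  viewR-⊆ : ∀ L w → viewR L w ⊆ w
  viewR-⊆ L (κ ∷ w) m with polarity κ
  viewR-⊆ L (κ ∷ w) (here e) | pos = here e
  viewR-⊆ L (κ ∷ w) (there m) | pos = there (viewR-⊆ L w m)
  ... | neg with does (initialIn? L κ)
  viewR-⊆ L (κ ∷ w) (here e) | neg | true = here e
  viewR-⊆ L (κ ∷ w) (here e) | neg | false = here e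
  viewR-⊆ L (κ ∷ w) (there m) | neg | false = there (seek-⊆ L κ w m)

  seek-⊆ : ∀ L κ w → seek L κ w ⊆ w
  seek-⊆ L κ (a ∷ w) m with does (justifies? a κ)
  seek-⊆ L κ (a ∷ w) (here e) | true = here e
  seek-⊆ L κ (a ∷ w) (there m) | true = there (viewR-⊆ L w m)
  seek-⊆ L κ (a ∷ w) m | false = there (seek-⊆ L κ w m)

view-⊆ : ∀ B q → view B q ⊆ q
view-⊆ B q m = reverse⁻ (viewR-⊆ (baseLoci B) (reverse q) (reverse⁻ m))

view-∷ʳ-by-viewR : ∀ B q x {T} → viewR (baseLoci B) (x ∷ reverse q) ≡ x ∷ T →
  view B (q ∷ʳ x) ≡ reverse T ∷ʳ x
view-∷ʳ-by-viewR B q x {T} e = begin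
  view B (q ∷ʳ x)                              ≡⟨ cong (reverse ∘ viewR (baseLoci B)) (reverse-++ q [ x ]) ⟩
  reverse (viewR (baseLoci B) (x ∷ reverse q)) ≡⟨ cong reverse e ⟩
  reverse (x ∷ T)                              ≡⟨ unfold-reverse x T ⟩
  reverse T ∷ʳ x                               ∎
  where open ≡-Reasoning

view-∷ʳ : ∀ B q x → ∃ λ W → view B (q ∷ʳ x) ≡ W ∷ʳ x
view-∷ʳ B q x = let T , e = viewR-head (baseLoci B) x (reverse q) in reverse T , view-∷ʳ-by-viewR B q x e

∈-view-∷ʳ : ∀ B q x → x ∈ view B (q ∷ʳ x)
∈-view-∷ʳ B q x = let W , e = view-∷ʳ B q x in subst (x ∈_) (sym e) (∈-++⁺ʳ W (here refl))

view-∷ʳ-pos : ∀ B q x → polarity x ≡ pos → view B (q ∷ʳ x) ≡ view B q ∷ʳ x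
view-∷ʳ-pos B q x x⁺ = view-∷ʳ-by-viewR B q x (viewR-pos (baseLoci B) x (reverse q) x⁺)

view-∷ʳ-initial : ∀ B q {ξ I} → ξ ∈ baseLoci B → view B (q ∷ʳ act neg ξ I) ≡ [ act neg ξ I ]
view-∷ʳ-initial B q ξ∈L = view-∷ʳ-by-viewR B q _ (viewR-initial (baseLoci B) (reverse q) ξ∈L)

view-∷ʳ-justified : ∀ B q {ξ I} → ξ ∉ baseLoci B → Any (λ a → Justifies a (act neg ξ I)) q →
  ∃₂ λ q₁ a → ∃ λ q₂ → q ≡ q₁ ++ a ∷ q₂ × Justifies a (act neg ξ I) ×
    view B (q ∷ʳ act neg ξ I) ≡ view B q₁ ∷ʳ a ∷ʳ act neg ξ I
view-∷ʳ-justified B q {ξ} {I} ξ∉L J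
  with w₁ , a , w₂ , e , Ja , s ← seek-justifier (baseLoci B) (act neg ξ I) (reverse q) (reverse⁺ J) =
  reverse w₂ , a , reverse w₁ , q≡ , Ja , view≡
  where
  open ≡-Reasoning
  L = baseLoci B
  κ = act neg ξ I
  q≡ : q ≡ reverse w₂ ++ a ∷ reverse w₁
  q≡ = begin
    q                        ≡⟨ sym (reverse-involutive q) ⟩
    reverse (reverse q)      ≡⟨ cong reverse e ⟩
    reverse (w₁ ++ a ∷ w₂)   ≡⟨ reverse-++-∷ w₁ a w₂ ⟩
    reverse w₂ ++ a ∷ reverse w₁ ∎
  view≡ : view B (q ∷ʳ κ) ≡ view B (reverse w₂) ∷ʳ a ∷ʳ κ
  view≡ = begin
    view B (q ∷ʳ κ)
      ≡⟨ view-∷ʳ-by-viewR B q κ (trans (viewR-justified L (reverse q) ξ∉L) (cong (κ ∷_) s)) ⟩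
    reverse (a ∷ viewR L w₂) ∷ʳ κ
      ≡⟨ cong (_∷ʳ κ) (unfold-reverse a (viewR L w₂)) ⟩
    reverse (viewR L w₂) ∷ʳ a ∷ʳ κ
      ≡⟨ cong (λ w → reverse (viewR L w) ∷ʳ a ∷ʳ κ) (sym (reverse-involutive w₂)) ⟩
    view B (reverse w₂) ∷ʳ a ∷ʳ κ
      ∎

module _ {B : List Sequent} {p : List Action} (base : IsBase B) (path : IsPath B p) where
  open IsPath path

  private
    L : List Locus
    L = baseLoci B

    S : Fin (length B) → Sequent
    S = lookup B

    ds : AllPairs Disjoint L
    ds = IsBase.disjoint base

  path-rooted : ∀ {κ} → κ ∈ p → RootedIn L κ
  path-rooted {daimon} _ = tt
  path-rooted {act _ _ _} m with hereditary m
  ... | inj₁ ()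
  ... | inj₂ (_ , refl , ξ↑) = ξ↑

  prefix-⊆ : ∀ {q κ r} → p ≡ q ++ κ ∷ r → q ⊆ p
  prefix-⊆ pe m = subst (_ ∈_) (sym pe) (∈-++⁺ˡ m)

  justified⇒∉ : ∀ {q κ r κ′} → p ≡ q ++ κ ∷ r → κ′ ∈ q → Justifies κ′ κ → ¬ InitialIn L κ
  justified⇒∉ pe κ′∈q = justified⇒¬InitialIn ds (path-rooted (prefix-⊆ pe κ′∈q))

  same-sequent : ∀ i k {ξ} → ξ ∈ seqLoci (S i) → ξ ∈ seqLoci (S k) → i ≡ k
  same-sequent i k ξ∈ᵢ ξ∈ₖ = HerJustIn-same-sequent B ds i k (HerJustIn-refl ξ∈ᵢ) (HerJustIn-refl ξ∈ₖ)

  path-based : ∀ {q κ r} → p ≡ q ++ κ ∷ r → ∀ k → BasedOn (S k) κ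
  path-based {κ = daimon} _ _ = tt
  path-based {q} {act pos ξ I} {r} pe k ξ∈ with justifiedOrInitial q pos ξ I r pe
  ... | inj₁ (_ , κ′∈q , J) = ⊥-elim (justified⇒∉ pe κ′∈q J (seqLoci⊆baseLoci B k ξ∈))
  ... | inj₂ (inj₁ (() , _))
  ... | inj₂ (inj₂ (_ , ξ∈Δ))
    with refl ← same-sequent (index ξ∈Δ) k (Δ⊆seqLoci _ (lookup-index ξ∈Δ)) ξ∈ = lookup-index ξ∈Δ
  path-based {q} {act neg ξ I} {r} pe k ξ∈ with justifiedOrInitial q neg ξ I r pe
  ... | inj₁ (_ , κ′∈q , J) = ⊥-elim (justified⇒∉ pe κ′∈q J (seqLoci⊆baseLoci B k ξ∈))
  ... | inj₂ (inj₂ (() , _))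
  ... | inj₂ (inj₁ (_ , Γ≡ξ))
    with refl ← same-sequent (index Γ≡ξ) k (Γ⊆seqLoci _ (lookup-index Γ≡ξ)) ξ∈ = lookup-index Γ≡ξ

  path-fresh : ∀ {q κ r V} → p ≡ q ++ κ ∷ r → V ⊆ q → FreshFocus V κ
  path-fresh {κ = daimon} _ _ = tt
  path-fresh {q} {act ε ξ I} {r} pe V⊆q ξ∈ = Unique-++-∷⇒∉ (foci q) foci-unique (foci-⊆ V⊆q ξ∈)
    where
    foci-unique : Unique (foci q ++ ξ ∷ foci r)
    foci-unique = subst Unique (trans (cong foci pe) (mapMaybe-++ focus? q (act ε ξ I ∷ r))) distinctFoci

  path-daimon∉ : ∀ {q κ r} → p ≡ q ++ κ ∷ r → daimon ∉ q
  path-daimon∉ {κ = κ} {r} pe d∈q with q₁ , q₂ , refl ← ∈-∃++ d∈q =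
    ++-∷≢[] q₂ (daimonLast q₁ (q₂ ++ κ ∷ r) (trans pe (++-assoc q₁ (daimon ∷ q₂) (κ ∷ r))))

  extend : ∀ {q κ r V W y k} → p ≡ q ++ κ ∷ r → V ⊆ q →
    V ≡ W ∷ʳ y → polarity κ ≡ dual (polarity y) →
    IsChronicleBasedOn (S k) V → Enabled (S k) V κ → IsChronicleBasedOn (S k) (V ∷ʳ κ)
  extend {k = k} pe V⊆q V≡ alt ch en =
    chronicle-∷ʳ ch V≡ alt en (path-fresh pe V⊆q) (path-daimon∉ pe ∘ V⊆q) (path-based pe k)

  extend-positive : ∀ {q′ y κ r k} → p ≡ q′ ∷ʳ y ++ κ ∷ r → polarity κ ≡ pos →
    IsChronicleBasedOn (S k) (view B (q′ ∷ʳ y)) → Enabled (S k) (view B (q′ ∷ʳ y)) κ →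
    IsChronicleBasedOn (S k) (view B (q′ ∷ʳ y ∷ʳ κ))
  extend-positive {q′} {y} {κ} {r} pe κ⁺ ch en rewrite view-∷ʳ-pos B (q′ ∷ʳ y) κ κ⁺ =
    extend pe (view-⊆ B _) (proj₂ (view-∷ʳ B q′ y)) y-then-κ ch en
    where
    y-then-κ : polarity κ ≡ dual (polarity y)
    y-then-κ = alternating q′ y κ r (trans pe (∷ʳ-++ q′ y (κ ∷ r)))

  ViewChronicle : List Action → Set
  ViewChronicle q = ∃ λ k → IsChronicleBasedOn (S k) (view B q)

  ShorterViews : List Action → Set
  ShorterViews q = ∀ q′ y {r} → p ≡ q′ ++ y ∷ r → length q′ < length q → ViewChronicle (q′ ∷ʳ y)

  last-view : ∀ {q′ y κ r} → p ≡ q′ ∷ʳ y ++ κ ∷ r →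
    ShorterViews (q′ ∷ʳ y) → ViewChronicle (q′ ∷ʳ y)
  last-view {q′} {y} pe ih = ih q′ y (trans pe (∷ʳ-++ q′ y _)) (length-<-++-∷ q′)

  daimon-step : ∀ q {r} → p ≡ q ++ daimon ∷ r → ShorterViews q → ViewChronicle (q ∷ʳ daimon)
  daimon-step q {r} pe ih with initLast q
  ... | [] = proj₁ (daimonFirst r pe) , chronicle-[ daimon ] tt tt
  ... | q′ ∷ʳ′ y = let k , ch = last-view pe ih in k , extend-positive pe refl ch tt

  justified-positive-step : ∀ q {ξ I r κ′} → p ≡ q ++ act pos ξ I ∷ r →
    κ′ ∈ q → Justifies κ′ (act pos ξ I) → ShorterViews q → ViewChronicle (q ∷ʳ act pos ξ I)
  justified-positive-step q {ξ} {I} {r} {κ′} pe κ′∈q J ih with initLast q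
  ... | [] = ⊥-elim (¬Any[] κ′∈q)
  ... | q′ ∷ʳ′ y =
    let k , ch = last-view pe ih
        κ′∈view = viewCondition q ξ I r κ′ pe κ′∈q (justifier-polarity J) J
    in k , extend-positive pe refl ch (inj₁ (κ′ , κ′∈view , J))

  initial-positive-step : ∀ q {ξ I r} i → p ≡ q ++ act pos ξ I ∷ r → ξ ∈ Δ (S i) →
    ShorterViews q → ViewChronicle (q ∷ʳ act pos ξ I)
  initial-positive-step q {ξ} {I} {r} i pe ξ∈Δ ih with initialCondition q ξ I r i pe ξ∈Δ
  ... | inj₁ (refl , _) =
    i , chronicle-[ act pos ξ I ] (inj₂ (Δ⊆seqLoci _ ξ∈Δ)) (path-based {q = []} pe i)
  ... | inj₂ (q′ , ζ , J , refl , ζ↑) =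
    let k , ch = last-view pe ih
        -- the preceding negative action ends the view of q, so its focus ζ lies under S k too
        ζ↑ₖ = All.lookup (chronicle-rooted ch) (∈-view-∷ʳ B q′ (act neg ζ J))
        i≡k = HerJustIn-same-sequent B ds i k ζ↑ ζ↑ₖ
    in k , extend-positive pe refl ch (inj₂ (Δ⊆seqLoci _ (subst (λ i → ξ ∈ Δ (S i)) i≡k ξ∈Δ)))

  negative-step : ∀ q {ξ I r} → p ≡ q ++ act neg ξ I ∷ r → ShorterViews q →
    ViewChronicle (q ∷ʳ act neg ξ I)
  negative-step q {ξ} {I} {r} pe ih with justifiedOrInitial q neg ξ I r pe
  ... | inj₂ (inj₂ (() , _))
  ... | inj₂ (inj₁ (_ , Γ≡ξ)) =
    let ξ∈ = Γ⊆seqLoci _ (lookup-index Γ≡ξ) in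
    index Γ≡ξ , subst (IsChronicleBasedOn _) (sym (view-∷ʳ-initial B q (seqLoci⊆baseLoci B _ ξ∈)))
                  (chronicle-[ act neg ξ I ] (inj₁ (ξ∈ , refl)) (path-based pe _))
  ... | inj₁ (κ′ , κ′∈q , J) with view-∷ʳ-justified B q (justified⇒∉ pe κ′∈q J) (lose κ′∈q J)
  ...   | q₁ , a , q₂ , refl , Ja , view≡ =
    let a⁺ = justifier-polarity Ja
        k , ch = ih q₁ a (trans pe (++-assoc q₁ (a ∷ q₂) _)) (length-<-++-∷ q₁)
        V⊆q = SubsetP.++⁺ (view-⊆ B q₁) (SubsetP.xs⊆xs++ys [ a ] q₂)
        chV = subst (IsChronicleBasedOn (S k)) (view-∷ʳ-pos B q₁ a a⁺) ch
    in k , subst (IsChronicleBasedOn (S k)) (sym view≡)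
             (extend pe V⊆q refl (cong dual (sym a⁺)) chV (inj₂ (view B q₁ , a , refl , a⁺ , Ja)))

  view-step : ∀ q {κ r} → p ≡ q ++ κ ∷ r → ShorterViews q → ViewChronicle (q ∷ʳ κ)
  view-step q {daimon} pe = daimon-step q pe
  view-step q {act neg _ _} pe = negative-step q pe
  view-step q {act pos ξ I} {r} pe with justifiedOrInitial q pos ξ I r pe
  ... | inj₁ (_ , κ′∈q , J) = justified-positive-step q pe κ′∈q J
  ... | inj₂ (inj₁ (() , _))
  ... | inj₂ (inj₂ (_ , ξ∈Δ)) = initial-positive-step q (index ξ∈Δ) pe (lookup-index ξ∈Δ)

  prefix-view-chronicle : ∀ q {κ r} → Acc _<_ (length q) → p ≡ q ++ κ ∷ r → ViewChronicle (q ∷ʳ κ)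
  prefix-view-chronicle q (acc rs) pe =
    view-step q pe λ q′ y pe′ lt → prefix-view-chronicle q′ (rs lt) pe′

proposition3p4 : (B : List Sequent) (p : List Action) → IsBase B → IsPath B p → p ≢ [] →
    ∃ λ (k : Fin (length B)) → IsChronicleBasedOn (lookup B k) (view B p)
proposition3p4 B p base path p≢[] with initLast p
... | [] = ⊥-elim (p≢[] refl)
... | q ∷ʳ′ κ = prefix-view-chronicle base path q (<-wellFounded (length q)) refl
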